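{- Let $\lambda X$ be a supersorted pure type system. If $\Gamma,x:A\vdash M:B$ is derivable in $\lambda X^{h+}$, then there is $s\in\mathcal S$ such that $\Gamma\vdash A:s$ is derivable in $\lambda X^{h+}$.
   Context: Pure type systems (PTS): variables, constants $\mathcal C$, sorts $\mathcal S\subseteq\mathcal C$, axioms $\mathcal A$ ($c:s$), rules $\mathcal R\subseteq\mathcal S^3$; pseudoterms $\mathcal T::=V\mid\mathcal C\mid\Pi V{:}\mathcal T.\mathcal T\mid\lambda V{:}\mathcal T.\mathcal T\mid\mathcal T\mathcal T$; PTS rules include (start): from $\Gamma\vdash A:s$ ($s\in\mathcal S$) infer $\Gamma,x:A\vdash x:A$ ($x$ fresh), and (weakening): from $\Gamma\vdash M:B$ and $\Gamma\vdash A:s$ infer $\Gamma,x:A\vdash M:B$ ($x$ fresh); also (application) $\Gamma\vdash M:\Pi x{:}A.B$, $\Gamma\vdash N:A\Rightarrow\Gamma\vdash MN:B[x:=N]$ and (conversion) $\Gamma\vdash M:A$, $\Gamma\vdash B:s$, $A=_\beta B\Rightarrow\Gamma\vdash M:B$. Supersorted: every constant $c$ has some $(c:s)\in\mathcal A$, and for all $s_1,s_2\in\mathcal S$ some $(s_1,s_2,s_3)\in\mathcal R$. Corresponding HPTS $\lambda X^h$: a system with empty contexts only, generated by the axioms of $\mathcal A$ and of a set $\mathcal B$ of empty-context judgements $\vdash M:A$ (instances, derivable in $\lambda X$, of schemes typing the terms $\lambda u{:}s_1.\lambda v{:}(\Pi x{:}u.s_2).\Pi x{:}u.vx$, $\lambda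 x{:}s_1.\lambda y{:}x.y$, $\lambda x{:}s_1.\lambda y{:}s_2.\lambda z{:}x.\lambda u{:}y.z$, the S-combinator term, closed under two generation rules), by (application), (conversion), (type reduction) $\vdash M:A$, $A\to_\beta B\Rightarrow\vdash M:B$, and (subject reduction) $\vdash M:A$, $M\to_\beta N\Rightarrow\vdash N:A$. $\lambda X^{h+}$: derivable judgements $\Gamma\vdash M:A$ generated by the axioms of $\mathcal A\cup\mathcal B$ (with empty context), the rules (application), (conversion), (type reduction), (subject reduction) with an arbitrary context $\Gamma$ common to premises and conclusion, and the (start) and (weakening) rules of $\lambda X$. -}

module Defs where

open import Data.Nat using (ℕ; zero; suc; pred; _<ᵇ_; _≡ᵇ_)
open import Data.Bool using (if_then_else_)
open import Data.List using (List; []; _∷_)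
open import Data.Product using (Σ; ∃; _×_)
open import Relation.Binary.Construct.Closure.Equivalence using (EqClosure)

record PTS : Set₁ where
  field
    Const : Set
    Sort  : Const → Set
    Axiom : Const → Const → Set
    Rule  : Const → Const → Const → Set
    axiom-sort : ∀ {c s} → Axiom c s → Sort s
    rule-sorts : ∀ {s₁ s₂ s₃} → Rule s₁ s₂ s₃ → Sort s₁ × Sort s₂ × Sort s₃

module Syntax (X : PTS) where
  open PTS X

  -- pseudoterms, variables as de Bruijn indices (binders bind index 0)
  data Term : Set where
    var   : ℕ → Term
    const : Const → Term
    Π     : Term → Term → Term   -- Π x:A. B   (B under one binder)
    ƛ     : Term → Term → Term   -- λ x:A. M   (M under one binder)
    _·_   : Term → Term → Term

  infixl 7 _·_

  ↑ : ℕ → Term → Term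
  ↑ c (var i)   = if i <ᵇ c then var i else var (suc i)
  ↑ c (const k) = const k
  ↑ c (Π A B)   = Π (↑ c A) (↑ (suc c) B)
  ↑ c (ƛ A M)   = ƛ (↑ c A) (↑ (suc c) M)
  ↑ c (M · N)   = ↑ c M · ↑ c N

  ↑ⁿ : ℕ → Term → Term
  ↑ⁿ zero    t = t
  ↑ⁿ (suc n) t = ↑ 0 (↑ⁿ n t)

  subst : ℕ → Term → Term → Term
  subst j N (var i)   =
    if i <ᵇ j then var i else (if i ≡ᵇ j then ↑ⁿ j N else var (pred i))
  subst j N (const k) = const k
  subst j N (Π A B)   = Π (subst j N A) (subst (suc j) N B)
  subst j N (ƛ A M)   = ƛ (subst j N A) (subst (suc j) N M)
  subst j N (M · P)   = subst j N M · subst j N P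

  -- B [x := N] where x is the variable bound by the enclosing binder
  _[0≔_] : Term → Term → Term
  B [0≔ N ] = subst 0 N B

  infix 4 _→β_
  data _→β_ : Term → Term → Set where
    β     : ∀ {A M N} → (ƛ A M · N) →β (M [0≔ N ])
    Π₁    : ∀ {A A' B} → A →β A' → Π A B →β Π A' B
    Π₂    : ∀ {A B B'} → B →β B' → Π A B →β Π A B'
    ƛ₁    : ∀ {A A' M} → A →β A' → ƛ A M →β ƛ A' M
    ƛ₂    : ∀ {A M M'} → M →β M' → ƛ A M →β ƛ A M'
    app₁  : ∀ {M M' N} → M →β M' → M · N →β M' · N
    app₂  : ∀ {M N N'} → N →β N' → M · N →β M · N'

  infix 4 _=β_
  _=β_ : Term → Term → Set
  _=β_ = EqClosure _→β_

  -- contexts: Γ , x:A is written A ∷ Γ (most recent declaration first)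
  Ctx : Set
  Ctx = List Term

  infix 3 _⊢_∶_
  data _⊢_∶_ : Ctx → Term → Term → Set where
    axiom  : ∀ {c s} → Axiom c s → [] ⊢ const c ∶ const s
    start  : ∀ {Γ A s} → Sort s → Γ ⊢ A ∶ const s →
             (A ∷ Γ) ⊢ var 0 ∶ ↑ 0 A
    weak   : ∀ {Γ M B A s} → Sort s → Γ ⊢ M ∶ B → Γ ⊢ A ∶ const s →
             (A ∷ Γ) ⊢ ↑ 0 M ∶ ↑ 0 B
    product : ∀ {Γ A B s₁ s₂ s₃} → Rule s₁ s₂ s₃ →
             Γ ⊢ A ∶ const s₁ → (A ∷ Γ) ⊢ B ∶ const s₂ → Γ ⊢ Π A B ∶ const s₃
    app    : ∀ {Γ M N A B} → Γ ⊢ M ∶ Π A B → Γ ⊢ N ∶ A → Γ ⊢ M · N ∶ B [0≔ N ]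
    abs    : ∀ {Γ A M B s} → Sort s → (A ∷ Γ) ⊢ M ∶ B → Γ ⊢ Π A B ∶ const s →
             Γ ⊢ ƛ A M ∶ Π A B
    conv   : ∀ {Γ M A B s} → Sort s → Γ ⊢ M ∶ A → Γ ⊢ B ∶ const s → A =β B →
             Γ ⊢ M ∶ B

  Supersorted : Set
  Supersorted =
    (∀ c → ∃ λ s → Axiom c s) ×
    (∀ s₁ s₂ → Sort s₁ → Sort s₂ → ∃ λ s₃ → Rule s₁ s₂ s₃)

  -- λX^{h+}, relative to a set 𝓑 of empty-context judgements ⊢ M : A
  -- (each derivable in λX)
  module HPlus (𝓑 : Term → Term → Set) where
    infix 3 _⊢ʰ⁺_∶_
    data _⊢ʰ⁺_∶_ : Ctx → Term → Term → Set where
      axiom  : ∀ {c s} → Axiom c s → [] ⊢ʰ⁺ const c ∶ const s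
      axiomB : ∀ {M A} → 𝓑 M A → [] ⊢ʰ⁺ M ∶ A
      app    : ∀ {Γ M N A B} → Γ ⊢ʰ⁺ M ∶ Π A B → Γ ⊢ʰ⁺ N ∶ A →
               Γ ⊢ʰ⁺ M · N ∶ B [0≔ N ]
      conv   : ∀ {Γ M A B s} → Sort s → Γ ⊢ʰ⁺ M ∶ A → Γ ⊢ʰ⁺ B ∶ const s →
               A =β B → Γ ⊢ʰ⁺ M ∶ B
      tyred  : ∀ {Γ M A B} → Γ ⊢ʰ⁺ M ∶ A → A →β B → Γ ⊢ʰ⁺ M ∶ B
      subred : ∀ {Γ M N A} → Γ ⊢ʰ⁺ M ∶ A → M →β N → Γ ⊢ʰ⁺ N ∶ A
      start  : ∀ {Γ A s} → Sort s → Γ ⊢ʰ⁺ A ∶ const s →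
               (A ∷ Γ) ⊢ʰ⁺ var 0 ∶ ↑ 0 A
      weak   : ∀ {Γ M B A s} → Sort s → Γ ⊢ʰ⁺ M ∶ B → Γ ⊢ʰ⁺ A ∶ const s →
               (A ∷ Γ) ⊢ʰ⁺ ↑ 0 M ∶ ↑ 0 B

module Submission where

open import Defs
open import Data.List using ([]; _∷_)
open import Data.Product using (∃; _×_; _,_)

-- Only (start) and (weakening) extend a context, and both have Γ ⊢ A : s as a
-- premise; every other rule with a nonempty context inherits it from a premise.
module _ (X : PTS) (𝓑 : Syntax.Term X → Syntax.Term X → Set) where
  open PTS X
  open Syntax X
  open HPlus 𝓑

  context-head-sorted : ∀ {Γ A M B} → (A ∷ Γ) ⊢ʰ⁺ M ∶ B →
                        ∃ λ s → Sort s × (Γ ⊢ʰ⁺ A ∶ const s)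
  context-head-sorted (start  {s = s} s-sort ⊢A)   = s , s-sort , ⊢A
  context-head-sorted (weak   {s = s} s-sort _ ⊢A) = s , s-sort , ⊢A
  context-head-sorted (app    ⊢M _)                = context-head-sorted ⊢M
  context-head-sorted (conv   _ ⊢M _ _)            = context-head-sorted ⊢M
  context-head-sorted (tyred  ⊢M _)                = context-head-sorted ⊢M
  context-head-sorted (subred ⊢M _)                = context-head-sorted ⊢M

lemma24 : (X : PTS) → let open PTS X in let open Syntax X in
    Supersorted →
    (𝓑 : Term → Term → Set) → (∀ {M A} → 𝓑 M A → [] ⊢ M ∶ A) →
    let open HPlus 𝓑 in
    ∀ {Γ A M B} → (A ∷ Γ) ⊢ʰ⁺ M ∶ B →
    ∃ λ s → Sort s × (Γ ⊢ʰ⁺ A ∶ const s)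
lemma24 X _ 𝓑 _ = context-head-sorted X 𝓑
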